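{- Let $S$ be a term graph and $p$ a position in $S$. (1) If $S(\uparrow_p)^{\ell}T$, then $\ell\le |p|$ and $|T|\le |S|+|p|$. (2) If $S(\downarrow_p)^{\ell}T$, then $\ell\le |S|_p|$ and $|T|\le|S|$.
   Context: A term graph $S$ over signature $\mathcal F$ and variables $\mathcal V$ is a finite acyclic rooted graph (root from which all nodes are reachable) with labels in $\mathcal F\cup\mathcal V$ and ordered successor lists, where a node labelled with a $k$-ary $f$ has $k$ successors, variable nodes have none, and equal variable labels imply equal nodes. $|S|$ is the number of nodes; $|p|$ is the length of position $p$; $R^\ell$ is the $\ell$-fold composition. $\mathrm{Pos}_S(u)$ is the set of successor-index sequences of paths from the root to $u$; $u$ corresponds to $p$ if $p\in\mathrm{Pos}_S(u)$; $S|_p$ is the subgraph reachable from the node corresponding to $p$; $u$ is strictly below $p$ if it corresponds to a $q$ with $p$ a proper prefix of $q$; $p\le q$ means prefix. $S\geq_m T$: $m$ maps nodes of $S$ to those of $T$, preserves the root, and for all nodes $w$, $\mathrm{lab}_T(m(w))=\mathrm{lab}_S(w)$, $\mathrm{succ}_T(m(w))=m^*(\mathrm{succ}_S(w))$. Fix a strict total order $\succ$ on nodes; for nodes $u\succ v$, $S\rhd_{u\mapsto v}T$ means $T$ is a term graph and $S\geq_m T$ for $m(u)=v$, $m(w)=w$ otherwise. Fold: $S\downarrow_p T$ if $S\rhd_{u\mapsto v}T$ for nodes $u,v$ strictly below $p$ in $S$. Unfold: $S\uparrow_p T$ if $T\rhd_{u\mapsto v}S$ for some node $u$ of $T$ with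 $\mathrm{Pos}_T(u)=\{q\}$, $q\le p$. -}

module Defs where

open import Data.Nat using (ℕ; zero; suc; _≟_)
open import Data.List using (List; []; _∷_; length; map; _++_)
open import Data.List.Membership.Propositional using (_∈_)
open import Data.List.Relation.Unary.Unique.Propositional using (Unique)
open import Data.Sum using (_⊎_; inj₁; inj₂)
open import Data.Product using (Σ; ∃; _×_; _,_)
open import Data.Bool using (if_then_else_)
open import Relation.Nullary.Decidable using (⌊_⌋)
open import Relation.Binary.PropositionalEquality using (_≡_)

-- Nodes are drawn from the universe ℕ.
-- A position is a list of successor indices (0-based).

data SuccAt : List ℕ → ℕ → ℕ → Set where
  here  : ∀ {x xs} → SuccAt (x ∷ xs) zero x
  there : ∀ {y xs i x} → SuccAt xs i x → SuccAt (y ∷ xs) (suc i) x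

data Prefix : List ℕ → List ℕ → Set where
  []  : ∀ {q} → Prefix [] q
  _∷_ : ∀ x {p q} → Prefix p q → Prefix (x ∷ p) (x ∷ q)

ProperPrefix : List ℕ → List ℕ → Set
ProperPrefix p q = Prefix p q × Σ ℕ λ x → Σ (List ℕ) λ r → q ≡ p ++ (x ∷ r)

data PathIn (sc : ℕ → List ℕ) : ℕ → List ℕ → ℕ → Set where
  at-[] : ∀ {w} → PathIn sc w [] w
  at-∷  : ∀ {w i w' p u} → SuccAt (sc w) i w' → PathIn sc w' p u → PathIn sc w (i ∷ p) u

-- A term graph over a signature (F, ar) and variables V.
-- lab and succ are total functions on ℕ; only their values on `nodes` matter.
record TermGraph (F : Set) (ar : F → ℕ) (V : Set) : Set where
  field
    nodes  : List ℕ
    nodes-unique : Unique nodes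
    root   : ℕ
    lab    : ℕ → F ⊎ V
    succ   : ℕ → List ℕ
    root-node : root ∈ nodes
    succ-closed : ∀ w → w ∈ nodes → ∀ w' → w' ∈ succ w → w' ∈ nodes
    fun-arity : ∀ w → w ∈ nodes → ∀ f → lab w ≡ inj₁ f → length (succ w) ≡ ar f
    var-leaf  : ∀ w → w ∈ nodes → ∀ x → lab w ≡ inj₂ x → succ w ≡ []
    var-inj   : ∀ w w' → w ∈ nodes → w' ∈ nodes → ∀ x →
                lab w ≡ inj₂ x → lab w' ≡ inj₂ x → w ≡ w'
    acyclic   : ∀ w → w ∈ nodes → ∀ p → PathIn succ w p w → p ≡ []
    rooted    : ∀ w → w ∈ nodes → ∃ λ p → PathIn succ root p w

open TermGraph public

module _ {F : Set} {ar : F → ℕ} {V : Set} where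

  size : TermGraph F ar V → ℕ
  size S = length (nodes S)

  At : (S : TermGraph F ar V) → ℕ → List ℕ → ℕ → Set
  At S = PathIn (succ S)

  Corr : (S : TermGraph F ar V) → List ℕ → ℕ → Set
  Corr S p u = At S (root S) p u

  IsPosition : TermGraph F ar V → List ℕ → Set
  IsPosition S p = ∃ λ u → Corr S p u

  Reach : TermGraph F ar V → ℕ → ℕ → Set
  Reach S u w = ∃ λ q → At S u q w

  StrictlyBelow : TermGraph F ar V → ℕ → List ℕ → Set
  StrictlyBelow S u p = ∃ λ q → ProperPrefix p q × Corr S q u

  UniquePos : TermGraph F ar V → ℕ → List ℕ → Set
  UniquePos S u q = Corr S q u × (∀ q' → Corr S q' u → q' ≡ q)

  Hom : TermGraph F ar V → (ℕ → ℕ) → TermGraph F ar V → Set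
  Hom S m T =
    (∀ w → w ∈ nodes S → m w ∈ nodes T) ×
    (m (root S) ≡ root T) ×
    (∀ w → w ∈ nodes S → lab T (m w) ≡ lab S w) ×
    (∀ w → w ∈ nodes S → succ T (m w) ≡ map m (succ S w))

  redirect : ℕ → ℕ → ℕ → ℕ
  redirect u v w = if ⌊ w ≟ u ⌋ then v else w

  Collapse : (ℕ → ℕ → Set) → TermGraph F ar V → ℕ → ℕ → TermGraph F ar V → Set
  Collapse _≻_ S u v T = u ∈ nodes S × v ∈ nodes S × u ≻ v × Hom S (redirect u v) T

  Fold : (ℕ → ℕ → Set) → List ℕ → TermGraph F ar V → TermGraph F ar V → Set
  Fold _≻_ p S T = ∃ λ u → ∃ λ v →
    StrictlyBelow S u p × StrictlyBelow S v p × Collapse _≻_ S u v T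

  Unfold : (ℕ → ℕ → Set) → List ℕ → TermGraph F ar V → TermGraph F ar V → Set
  Unfold _≻_ p S T = ∃ λ u → ∃ λ v → ∃ λ q →
    u ∈ nodes T × UniquePos T u q × Prefix q p × Collapse _≻_ T u v S

data Iter {A : Set} (R : A → A → Set) : ℕ → A → A → Set where
  iter-zero : ∀ {x} → Iter R zero x x
  iter-suc  : ∀ {ℓ x y z} → R x y → Iter R ℓ y z → Iter R (suc ℓ) x z

module Submission where

open import Defs
open import Data.Nat using (ℕ; zero; suc; _≤_; _<_; _+_; z≤n; s≤s; s≤s⁻¹; _≟_)
open import Data.Nat.Properties
  using (≤-refl; ≤-reflexive; ≤-trans; +-identityʳ; +-suc; +-monoˡ-≤; +-monoʳ-≤; module ≤-Reasoning)
open import Data.List using (List; []; _∷_; _++_; length; map; filter; inits)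
open import Data.List.Properties using (length-map; filter-notAll; ≡-dec)
open import Data.List.Membership.Propositional using (_∈_)
open import Data.List.Membership.Propositional.Properties using (∈-map⁺; ∈-filter⁺)
open import Data.List.Relation.Binary.Subset.Propositional using (_⊆_)
open import Data.List.Relation.Unary.Any as Any using (here; there)
import Data.List.Relation.Unary.All as All
open import Data.List.Relation.Unary.AllPairs using ([]; _∷_)
open import Data.List.Relation.Unary.Unique.Propositional using (Unique)
import Data.List.Relation.Unary.Unique.Propositional.Properties as Unique
open import Data.Product using (_×_; _,_; ∃; proj₁; proj₂)
open import Function using (_∘_)
open import Function.Bundles using (_⇔_; Equivalence)
open import Relation.Binary.Definitions using (DecidableEquality; Irreflexive)
open import Relation.Binary.PropositionalEquality
open import Relation.Binary.Structures using (IsStrictTotalOrder)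
open import Relation.Nullary using (¬_; yes; no; contradiction)
open import Relation.Nullary.Decidable using (¬?)

-- A collapse S ▷_{u↦v} T is a surjective homomorphism, so |T| ≤ |S|, and every
-- node of S other than u survives in T, so |S| ≤ |T| + 1. A fold at p deletes
-- the node u, reachable from the node at p, while everything reachable from
-- the image of that node is the image of something reachable from it: the set
-- of nodes of S|_p loses an element with every fold. An unfolding at q ≤ p
-- makes q unshared (the only position of its node) where it was shared before,
-- and homomorphisms reflect unsharedness, so the positions unshared by the
-- successive unfoldings are distinct prefixes of p, all different from the
-- always unshared root position [].

module _ {A : Set} {R : A → A → Set} (f : A → ℕ) where

  Iter-antitone : (∀ {x y} → R x y → f y ≤ f x) →
                  ∀ {ℓ x y} → Iter R ℓ x y → f y ≤ f x
  Iter-antitone step iter-zero      = ≤-refl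
  Iter-antitone step (iter-suc r rs) = ≤-trans (Iter-antitone step rs) (step r)

  Iter-growth : (∀ {x y} → R x y → f y ≤ suc (f x)) →
                ∀ {ℓ x y} → Iter R ℓ x y → f y ≤ f x + ℓ
  Iter-growth step {x = x} iter-zero = ≤-reflexive (sym (+-identityʳ (f x)))
  Iter-growth step {suc ℓ} {x} {z} (iter-suc {y = y} r rs) = begin
    f z           ≤⟨ Iter-growth step rs ⟩
    f y + ℓ       ≤⟨ +-monoˡ-≤ ℓ (step r) ⟩
    suc (f x) + ℓ ≡⟨ sym (+-suc (f x) ℓ) ⟩
    f x + suc ℓ   ∎
    where open ≤-Reasoning

module Removal {A : Set} (_≟ᴬ_ : DecidableEquality A) where

  remove : A → List A → List A
  remove x = filter (λ y → ¬? (y ≟ᴬ x))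

  length-remove< : ∀ {x ys} → x ∈ ys → length (remove x ys) < length ys
  length-remove< {x} {ys} x∈ys =
    filter-notAll (λ y → ¬? (y ≟ᴬ x)) ys (Any.map (λ x≡y y≢x → y≢x (sym x≡y)) x∈ys)

  ∈-remove⁺ : ∀ {x y ys} → y ∈ ys → ¬ y ≡ x → y ∈ remove x ys
  ∈-remove⁺ {x} = ∈-filter⁺ (λ y → ¬? (y ≟ᴬ x))

  remove-Unique : ∀ {x ys} → Unique ys → Unique (remove x ys)
  remove-Unique {x} = Unique.filter⁺ (λ y → ¬? (y ≟ᴬ x))

  Unique-⊆⇒length≤ : ∀ {xs ys} → Unique xs → xs ⊆ ys → length xs ≤ length ys
  Unique-⊆⇒length≤ {[]}     _ _ = z≤n
  Unique-⊆⇒length≤ {x ∷ xs} {ys} (x∉xs ∷ uniq) xs⊆ys =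
    ≤-trans (s≤s (Unique-⊆⇒length≤ uniq xs⊆ys∖x)) (length-remove< (xs⊆ys (here refl)))
    where
    xs⊆ys∖x : xs ⊆ remove x ys
    xs⊆ys∖x y∈xs = ∈-remove⁺ (xs⊆ys (there y∈xs)) (λ y≡x → All.lookup x∉xs y∈xs (sym y≡x))

open Removal _≟_ using (remove; length-remove<; ∈-remove⁺; remove-Unique)

length-inits : ∀ {A : Set} (xs : List A) → length (inits xs) ≡ suc (length xs)
length-inits []       = refl
length-inits (x ∷ xs) = cong suc (trans (length-map (x ∷_) (inits xs)) (length-inits xs))

Prefix⇒∈inits : ∀ {q p} → Prefix q p → q ∈ inits p
Prefix⇒∈inits []       = here refl
Prefix⇒∈inits (x ∷ q≤p) = there (∈-map⁺ (x ∷_) (Prefix⇒∈inits q≤p))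

SuccAt⇒∈ : ∀ {xs i x} → SuccAt xs i x → x ∈ xs
SuccAt⇒∈ here      = here refl
SuccAt⇒∈ (there s) = there (SuccAt⇒∈ s)

SuccAt-functional : ∀ {xs i x y} → SuccAt xs i x → SuccAt xs i y → x ≡ y
SuccAt-functional here      here      = refl
SuccAt-functional (there s) (there t) = SuccAt-functional s t

SuccAt-map⁺ : ∀ (f : ℕ → ℕ) {xs i x} → SuccAt xs i x → SuccAt (map f xs) i (f x)
SuccAt-map⁺ f here      = here
SuccAt-map⁺ f (there s) = there (SuccAt-map⁺ f s)

SuccAt-map⁻ : ∀ (f : ℕ → ℕ) xs {i z} → SuccAt (map f xs) i z → ∃ λ y → SuccAt xs i y × f y ≡ z
SuccAt-map⁻ f (x ∷ xs) here = x , here , refl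
SuccAt-map⁻ f (x ∷ xs) (there s) with SuccAt-map⁻ f xs s
... | y , s′ , fy≡z = y , there s′ , fy≡z

PathIn-functional : ∀ {sc w q x y} → PathIn sc w q x → PathIn sc w q y → x ≡ y
PathIn-functional at-[]       at-[]         = refl
PathIn-functional (at-∷ s π) (at-∷ s′ π′) rewrite SuccAt-functional s s′ = PathIn-functional π π′

PathIn-++⁻ : ∀ {sc w} p {r x} → PathIn sc w (p ++ r) x → ∃ λ z → PathIn sc w p z × PathIn sc z r x
PathIn-++⁻ []      π          = _ , at-[] , π
PathIn-++⁻ (i ∷ p) (at-∷ s π) with PathIn-++⁻ p π
... | z , π₁ , π₂ = z , at-∷ s π₁ , π₂

module _ {F : Set} {ar : F → ℕ} {V : Set} where

  private
    Graph = TermGraph F ar V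

  redirect-self : ∀ u v → redirect {F} {ar} {V} u v u ≡ v
  redirect-self u v with u ≟ u
  ... | yes _   = refl
  ... | no u≢u = contradiction refl u≢u

  redirect-other : ∀ {u v w} → ¬ w ≡ u → redirect {F} {ar} {V} u v w ≡ w
  redirect-other {u} {v} {w} w≢u with w ≟ u
  ... | yes w≡u = contradiction w≡u w≢u
  ... | no _    = refl

  PathIn-nodes : ∀ (S : Graph) {w q x} → w ∈ nodes S → At S w q x → x ∈ nodes S
  PathIn-nodes S w∈S at-[]      = w∈S
  PathIn-nodes S w∈S (at-∷ s π) = PathIn-nodes S (succ-closed S _ w∈S _ (SuccAt⇒∈ s)) π

  Corr-nodes : ∀ (S : Graph) {q x} → Corr S q x → x ∈ nodes S
  Corr-nodes S = PathIn-nodes S (root-node S)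

  StrictlyBelow⇒Reach : ∀ (S : Graph) {p u w} → Corr S p u → StrictlyBelow S w p → Reach S u w
  StrictlyBelow⇒Reach S {p} p↦u (_ , (_ , x , r , refl) , q↦w) with PathIn-++⁻ p q↦w
  ... | z , p↦z , π rewrite PathIn-functional p↦z p↦u = x ∷ r , π

  module _ (S T : Graph) {m : ℕ → ℕ} (hom : Hom S m T) where

    private
      m-succ : ∀ {w} → w ∈ nodes S → succ T (m w) ≡ map m (succ S w)
      m-succ = proj₂ (proj₂ (proj₂ hom)) _

      m-root : m (root S) ≡ root T
      m-root = proj₁ (proj₂ hom)

    Hom-PathIn⁺ : ∀ {w q x} → w ∈ nodes S → At S w q x → At T (m w) q (m x)
    Hom-PathIn⁺ w∈S at-[]      = at-[]
    Hom-PathIn⁺ w∈S (at-∷ s π) =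
      at-∷ (subst (λ ws → SuccAt ws _ _) (sym (m-succ w∈S)) (SuccAt-map⁺ m s))
           (Hom-PathIn⁺ (succ-closed S _ w∈S _ (SuccAt⇒∈ s)) π)

    Hom-PathIn⁻ : ∀ {w q x} → w ∈ nodes S → At T (m w) q x →
                  ∃ λ y → At S w q y × m y ≡ x
    Hom-PathIn⁻ w∈S at-[] = _ , at-[] , refl
    Hom-PathIn⁻ {w} w∈S (at-∷ {i = i} s π)
      with SuccAt-map⁻ m (succ S w) (subst (λ ws → SuccAt ws i _) (m-succ w∈S) s)
    ... | w′ , s′ , refl with Hom-PathIn⁻ (succ-closed S _ w∈S _ (SuccAt⇒∈ s′)) π
    ... | y , π′ , my≡x = y , at-∷ s′ π′ , my≡x

    Hom-Corr⁺ : ∀ {q x} → Corr S q x → Corr T q (m x)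
    Hom-Corr⁺ q↦x = subst (λ r → At T r _ _) m-root (Hom-PathIn⁺ (root-node S) q↦x)

    Hom-Corr⁻ : ∀ {q x} → Corr T q x → ∃ λ y → Corr S q y × m y ≡ x
    Hom-Corr⁻ q↦x = Hom-PathIn⁻ (root-node S) (subst (λ r → At T r _ _) (sym m-root) q↦x)

    Hom-surjective : nodes T ⊆ map m (nodes S)
    Hom-surjective {w} w∈T with Hom-Corr⁻ (proj₂ (rooted T w w∈T))
    ... | y , q↦y , refl = ∈-map⁺ m (Corr-nodes S q↦y)

    Hom-size≤ : size T ≤ size S
    Hom-size≤ = subst (size T ≤_) (length-map m (nodes S))
      (Removal.Unique-⊆⇒length≤ _≟_ (nodes-unique T) Hom-surjective)

  Unshared : Graph → List ℕ → Set
  Unshared G q = ∃ λ x → UniquePos G x q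

  Unshared-[] : ∀ G → Unshared G []
  Unshared-[] G = root G , at-[] , acyclic G (root G) (root-node G)

  Hom-Unshared⁻ : ∀ (S T : Graph) {m q} → Hom S m T → Unshared T q → Unshared S q
  Hom-Unshared⁻ S T hom (x , q↦x , only-q) with Hom-Corr⁻ S T hom q↦x
  ... | y , q↦y , refl = y , q↦y , λ q′ q′↦y → only-q q′ (Hom-Corr⁺ S T hom q′↦y)

  module _ (T S : Graph) {u v : ℕ} (hom : Hom T (redirect {F} {ar} {V} u v) S) where

    redirect-size≤ : size T ≤ suc (size S)
    redirect-size≤ = Removal.Unique-⊆⇒length≤ _≟_ (nodes-unique T) nodes⊆u∷nodes
      where
      nodes⊆u∷nodes : nodes T ⊆ u ∷ nodes S
      nodes⊆u∷nodes {w} w∈T with w ≟ u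
      ... | yes w≡u = here w≡u
      ... | no w≢u  = there (subst (_∈ nodes S) (redirect-other w≢u) (proj₁ hom w w∈T))

    -- Any position q′ of v in T also leads to v in S, as does q; uniqueness of
    -- q in S would give q′ = q and hence u = v in T.
    redirect-shares : ∀ {q} → v ∈ nodes T → ¬ v ≡ u → Corr T q u → ¬ Unshared S q
    redirect-shares {q} v∈T v≢u q↦u (x , q↦x , only-q) with rooted T v v∈T
    ... | q′ , q′↦v = v≢u (PathIn-functional (subst (λ r → Corr T r v) q′≡q q′↦v) q↦u)
      where
      q↦v : Corr S q v
      q↦v = subst (Corr S q) (redirect-self u v) (Hom-Corr⁺ T S hom q↦u)
      q′≡q : q′ ≡ q
      q′≡q = only-q q′ (subst (Corr S q′) (trans (redirect-other v≢u) (PathIn-functional q↦v q↦x))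
                                          (Hom-Corr⁺ T S hom q′↦v))

  module _ {_≻_ : ℕ → ℕ → Set} (p : List ℕ) where

    Fold-size≤ : ∀ {ℓ} {S T : Graph} → Iter (Fold _≻_ p) ℓ S T → size T ≤ size S
    Fold-size≤ = Iter-antitone {R = Fold _≻_ p} size
      λ { {S} {T} (_ , _ , _ , _ , _ , _ , _ , hom) → Hom-size≤ S T hom }

    Unfold-size≤ : ∀ {ℓ} {S T : Graph} → Iter (Unfold _≻_ p) ℓ S T → size T ≤ size S + ℓ
    Unfold-size≤ = Iter-growth {R = Unfold _≻_ p} size
      λ { {S} {T} (_ , _ , _ , _ , _ , _ , _ , _ , _ , hom) → redirect-size≤ T S hom }

  module _ {_≻_ : ℕ → ℕ → Set} (p : List ℕ) (irrefl : Irreflexive _≡_ _≻_) where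

    private
      ≻⇒≢ : ∀ {u v} → u ≻ v → ¬ v ≡ u
      ≻⇒≢ u≻v v≡u = irrefl (sym v≡u) u≻v

    Fold-steps≤ : ∀ {ℓ} {S T : Graph} {u L} → Iter (Fold _≻_ p) ℓ S T → Corr S p u → Unique L →
                  (∀ {w} → Reach S u w → w ∈ L) → ℓ ≤ length L
    Fold-steps≤ iter-zero _ _ _ = z≤n
    Fold-steps≤ {S = S} {u = u} {L}
                (iter-suc {y = S′} (u₀ , v₀ , u₀-below , v₀-below , _ , _ , u₀≻v₀ , hom) folds)
                p↦u uniq reach⊆L =
      ≤-trans (s≤s (Fold-steps≤ folds (Hom-Corr⁺ S S′ hom p↦u) (remove-Unique uniq) reach′⊆L∖u₀))
              (length-remove< (reach⊆L (StrictlyBelow⇒Reach S p↦u u₀-below)))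
      where
      reach′⊆L∖u₀ : ∀ {w} → Reach S′ (redirect {F} {ar} {V} u₀ v₀ u) w → w ∈ remove u₀ L
      reach′⊆L∖u₀ (q , π) with Hom-PathIn⁻ S S′ hom (Corr-nodes S p↦u) π
      ... | y , π′ , refl with y ≟ u₀
      ... | yes refl = ∈-remove⁺ (reach⊆L (StrictlyBelow⇒Reach S p↦u v₀-below)) (≻⇒≢ u₀≻v₀)
      ... | no y≢u₀  = ∈-remove⁺ (reach⊆L (q , π′)) y≢u₀

    unfoldedPositions : ∀ {ℓ} {S T : Graph} → Iter (Unfold _≻_ p) ℓ S T → List (List ℕ)
    unfoldedPositions iter-zero                          = []
    unfoldedPositions (iter-suc (_ , _ , q , _) unfolds) = q ∷ unfoldedPositions unfolds

    length-unfoldedPositions : ∀ {ℓ} {S T : Graph} (unfolds : Iter (Unfold _≻_ p) ℓ S T) →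
                               length (unfoldedPositions unfolds) ≡ ℓ
    length-unfoldedPositions iter-zero           = refl
    length-unfoldedPositions (iter-suc _ unfolds) = cong suc (length-unfoldedPositions unfolds)

    unfoldedPositions-prefix : ∀ {ℓ} {S T : Graph} (unfolds : Iter (Unfold _≻_ p) ℓ S T) →
                               ∀ {q} → q ∈ unfoldedPositions unfolds → Prefix q p
    unfoldedPositions-prefix (iter-suc (_ , _ , _ , _ , _ , q≤p , _) _) (here refl) = q≤p
    unfoldedPositions-prefix (iter-suc _ unfolds) (there q∈) = unfoldedPositions-prefix unfolds q∈

    unfoldedPositions-shared : ∀ {ℓ} {S T : Graph} (unfolds : Iter (Unfold _≻_ p) ℓ S T) →
                               ∀ {q} → q ∈ unfoldedPositions unfolds → ¬ Unshared S q
    unfoldedPositions-shared {S = S}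
      (iter-suc {y = S′} (_ , _ , _ , _ , (q↦u , _) , _ , (_ , v∈ , u≻v , hom)) _) (here refl) =
      redirect-shares S′ S hom v∈ (≻⇒≢ u≻v) q↦u
    unfoldedPositions-shared {S = S}
      (iter-suc {y = S′} (_ , _ , _ , _ , _ , _ , (_ , _ , _ , hom)) unfolds) (there q∈) =
      unfoldedPositions-shared unfolds q∈ ∘ Hom-Unshared⁻ S′ S hom

    unfoldedPositions-unique : ∀ {ℓ} {S T : Graph} (unfolds : Iter (Unfold _≻_ p) ℓ S T) →
                               Unique (unfoldedPositions unfolds)
    unfoldedPositions-unique iter-zero = []
    unfoldedPositions-unique (iter-suc {y = S′} (u , _ , _ , _ , uniquePos , _) unfolds) =
      All.tabulate (λ k∈ q≡k → unfoldedPositions-shared unfolds k∈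
                                 (subst (Unshared S′) q≡k (u , uniquePos)))
      ∷ unfoldedPositions-unique unfolds

    Unfold-steps≤ : ∀ {ℓ} {S T : Graph} → Iter (Unfold _≻_ p) ℓ S T → ℓ ≤ length p
    Unfold-steps≤ {S = S} unfolds =
      s≤s⁻¹ (subst₂ _≤_ (cong suc (length-unfoldedPositions unfolds)) (length-inits p)
                        (Removal.Unique-⊆⇒length≤ (≡-dec _≟_) []∷K-unique []∷K⊆inits))
      where
      K = unfoldedPositions unfolds
      []∷K-unique : Unique ([] ∷ K)
      []∷K-unique = All.tabulate (λ q∈ []≡q → unfoldedPositions-shared unfolds q∈
                                                (subst (Unshared S) []≡q (Unshared-[] S)))
                    ∷ unfoldedPositions-unique unfolds
      []∷K⊆inits : [] ∷ K ⊆ inits p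
      []∷K⊆inits (here refl) = here refl
      []∷K⊆inits (there q∈)  = Prefix⇒∈inits (unfoldedPositions-prefix unfolds q∈)

lemma24 : (F : Set) (ar : F → ℕ) (V : Set)
          (_≻_ : ℕ → ℕ → Set) → IsStrictTotalOrder _≡_ _≻_ →
          (S : TermGraph F ar V) (p : List ℕ) → IsPosition S p →
          ((ℓ : ℕ) (T : TermGraph F ar V) → Iter (Unfold _≻_ p) ℓ S T →
             ℓ ≤ length p × size T ≤ size S + length p)
          ×
          ((ℓ : ℕ) (T : TermGraph F ar V) → Iter (Fold _≻_ p) ℓ S T →
             ((u : ℕ) (L : List ℕ) → Corr S p u → Unique L →
                ((w : ℕ) → Reach S u w ⇔ w ∈ L) → ℓ ≤ length L)
             × size T ≤ size S)
-- Neither bound needs p to be a position of S.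
lemma24 F ar V _≻_ sto S p _ =
  (λ ℓ T unfolds →
     let ℓ≤∣p∣ = Unfold-steps≤ p irrefl unfolds
     in ℓ≤∣p∣ , ≤-trans (Unfold-size≤ p unfolds) (+-monoʳ-≤ (size S) ℓ≤∣p∣)) ,
  (λ ℓ T folds →
     (λ u L p↦u uniq reach⇔L → Fold-steps≤ p irrefl folds p↦u uniq (Equivalence.to (reach⇔L _))) ,
     Fold-size≤ p folds)
  where open IsStrictTotalOrder sto using (irrefl)
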